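{- For every $n\geq 1$, the presentation "$n$-tower of $3$-frames" $\Delta(3,n)$ is projective within the class of modular lattices.
   Context: Lattice terms use $+$ for join and $\cdot$ (or juxtaposition) for meet; $x\leq y$ abbreviates the relation $x=xy$. A presentation consists of a list of generator symbols and a finite set of relations $s=t$ between lattice terms in these symbols; a model of it in a lattice $L$ is an assignment of elements of $L$ to the generator symbols satisfying all relations. A presentation with generator symbols $c_1,\ldots,c_k$ is projective within the class of modular lattices if there are lattice terms $t_1(\bar x),\ldots,t_k(\bar x)$ in $k$ variables such that for every modular lattice $L$ and all $a_1,\ldots,a_k\in L$: (1) $(t_1(\bar a),\ldots,t_k(\bar a))$ is a model of the presentation in $L$; (2) if $\bar a$ is a model then $t_i(\bar a)=a_i$ for all $i$. For lists $\bar x=(x_1,\ldots,x_m)$, $\bar y=(y_1,\ldots,y_m)$, the relation $\bar x\nearrow\bar y$ denotes the conjunction over $i=1,\ldots,m$ of $y_i=x_i+\prod_{j=1}^m y_j$ and $x_i=y_i\cdot\sum_{j=1}^m x_j$. A $2$-frame on symbols $(a_\bot,a_1,a_2,c_{12})$ is given by the relations $a_\bot=a_2a_1$, $a_\bot=a_1c_{12}=a_2c_{12}$, $a_1+a_2=a_1+c_{12}=a_2+c_{12}$. The $n$-tower of $2$-frames $\Delta(n)$ has the $4n$ distinct generator symbols $a^k_\bot,a^k_1,a^k_2,c^k_{12}$ ($k=1,\ldots,n$) and relations: for each $k$ the $2$-frame relations on $(a^k_\bot,a^k_1,a^k_2,c^k_{12})$, and for $1\leq k<n$ the relations $(a^k_1+a^k_2,\,a^k_2)\nearrow(a^{k+1}_1,\,a^{k+1}_\bot)$.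 The $n$-tower of $3$-frames $\Delta(3,n)$ has the generator symbols of $\Delta(n)$ together with two new symbols $a^1_3,c^1_{13}$, and relations: those of $\Delta(n)$; $a^1_\bot\leq a^1_3$; $\bigl(\sum s\bigr)\cdot a^1_3=a^1_\bot$, where the sum ranges over all generator symbols $s$ of $\Delta(n)$; and the $2$-frame relations on $(a^1_\bot,a^1_1,a^1_3,c^1_{13})$. -}

module Defs where

open import Level using (Level; _⊔_; Setω) renaming (suc to lsuc)
open import Data.Nat using (ℕ; zero; suc; _≤_; s≤s; z≤n)
open import Data.Fin using (Fin; inject₁) renaming (zero to fzero; suc to fsuc)
open import Data.List using (List; []; _∷_; _++_; map; concatMap; allFin)
open import Data.List.Relation.Unary.All using (All)
open import Data.Vec using (Vec; []; _∷_; toList)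
open import Data.Product using (_×_; _,_)
open import Algebra.Lattice.Bundles using (Lattice)

record ModularLattice (c ℓ : Level) : Set (lsuc (c ⊔ ℓ)) where
  field
    lattice : Lattice c ℓ
  open Lattice lattice public
  field
    modular : ∀ x y z → x ≈ (x ∧ z) → (x ∨ (y ∧ z)) ≈ ((x ∨ y) ∧ z)

infixl 6 _⊕_
infixl 7 _⊙_

data Term (G : Set) : Set where
  var : G → Term G
  _⊕_ : Term G → Term G → Term G
  _⊙_ : Term G → Term G → Term G

⟦_⟧ : ∀ {c ℓ} {G : Set} → Term G → (L : ModularLattice c ℓ) →
      (G → ModularLattice.Carrier L) → ModularLattice.Carrier L
⟦ var g ⟧ L a = a g
⟦ s ⊕ t ⟧ L a = ModularLattice._∨_ L (⟦ s ⟧ L a) (⟦ t ⟧ L a)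
⟦ s ⊙ t ⟧ L a = ModularLattice._∧_ L (⟦ s ⟧ L a) (⟦ t ⟧ L a)

Relation : Set → Set
Relation G = Term G × Term G

Presentation : Set → Set
Presentation G = List (Relation G)

IsModel : ∀ {c ℓ} {G : Set} (P : Presentation G) (L : ModularLattice c ℓ) →
          (G → ModularLattice.Carrier L) → Set ℓ
IsModel P L a = All (λ { (s , t) → ModularLattice._≈_ L (⟦ s ⟧ L a) (⟦ t ⟧ L a) }) P

record Projective {G : Set} (P : Presentation G) : Setω where
  field
    terms    : G → Term G
    model    : ∀ {c ℓ} (L : ModularLattice c ℓ) (a : G → ModularLattice.Carrier L) →
               IsModel P L (λ g → ⟦ terms g ⟧ L a)
    retract  : ∀ {c ℓ} (L : ModularLattice c ℓ) (a : G → ModularLattice.Carrier L) →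
               IsModel P L a → ∀ g → ModularLattice._≈_ L (⟦ terms g ⟧ L a) (a g)

_≤ᵣ_ : ∀ {G} → Term G → Term G → Relation G
x ≤ᵣ y = (x , x ⊙ y)

⋁ : ∀ {G} → Term G → List (Term G) → Term G
⋁ x []       = x
⋁ x (y ∷ ys) = x ⊕ ⋁ y ys

⋀ : ∀ {G} → Term G → List (Term G) → Term G
⋀ x []       = x
⋀ x (y ∷ ys) = x ⊙ ⋀ y ys

↗ : ∀ {G} {k : ℕ} → Vec (Term G) (suc k) → Vec (Term G) (suc k) → Presentation G
↗ {G} (x₀ ∷ xs) (y₀ ∷ ys) = go (x₀ ∷ xs) (y₀ ∷ ys)
  where
  X = ⋁ x₀ (toList xs)
  Y = ⋀ y₀ (toList ys)
  go : ∀ {m} → Vec (Term G) m → Vec (Term G) m → Presentation G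
  go [] [] = []
  go (x ∷ xs′) (y ∷ ys′) = (y , x ⊕ Y) ∷ (x , y ⊙ X) ∷ go xs′ ys′

frame2 : ∀ {G} → Term G → Term G → Term G → Term G → Presentation G
frame2 a⊥ a₁ a₂ c₁₂ =
  (a⊥ , a₂ ⊙ a₁) ∷
  (a⊥ , a₁ ⊙ c₁₂) ∷ (a₁ ⊙ c₁₂ , a₂ ⊙ c₁₂) ∷
  (a₁ ⊕ a₂ , a₁ ⊕ c₁₂) ∷ (a₁ ⊕ c₁₂ , a₂ ⊕ c₁₂) ∷ []

-- Generator symbols of Δ(3,n):  a^k_⊥, a^k_1, a^k_2, c^k_12 (k : Fin n,
-- with fzero standing for k = 1), and a^1_3, c^1_13.

data Gen3 (n : ℕ) : Set where
  a⊥  : Fin n → Gen3 n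
  a₁  : Fin n → Gen3 n
  a₂  : Fin n → Gen3 n
  c₁₂ : Fin n → Gen3 n
  a₃  : Gen3 n
  c₁₃ : Gen3 n

towerRels : (m : ℕ) → Presentation (Gen3 (suc m))
towerRels m =
  concatMap (λ k → frame2 (var (a⊥ k)) (var (a₁ k)) (var (a₂ k)) (var (c₁₂ k)))
            (allFin (suc m))
  ++
  concatMap (λ k → ↗ (var (a₁ (inject₁ k)) ⊕ var (a₂ (inject₁ k)) ∷ var (a₂ (inject₁ k)) ∷ [])
                     (var (a₁ (fsuc k)) ∷ var (a⊥ (fsuc k)) ∷ []))
            (allFin m)

sumΔ : (m : ℕ) → Term (Gen3 (suc m))
sumΔ m = ⋁ (var (a⊥ fzero))
           (concatMap (λ k → var (a⊥ k) ∷ var (a₁ k) ∷ var (a₂ k) ∷ var (c₁₂ k) ∷ [])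
                      (allFin (suc m)))

Δ3 : (n : ℕ) → 1 ≤ n → Presentation (Gen3 n)
Δ3 (suc m) _ =
  towerRels m ++
  ( var (a⊥ fzero) ≤ᵣ var a₃ ∷
    (sumΔ m ⊙ var a₃ , var (a⊥ fzero)) ∷ [] ) ++
  frame2 (var (a⊥ fzero)) (var (a₁ fzero)) (var a₃) (var c₁₃)

-- The relations of Δ(3,n) force a₁ᵏ = a₁¹ + a⊥ᵏ, so a model is determined by a⊥¹, a₁¹, a₃, c₁₃
-- and the triples (a⊥ᵏ, a₂ᵏ, c₁₂ᵏ); in these coordinates the models are exactly the "normal"
-- assignments: a chain a⊥¹ ≤ a⊥ᵏ ≤ a₂ᵏ ≤ a⊥ᵏ⁺¹, a 3-frame (a⊥¹, a₁¹, a₃, c₁₃) whose span meets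
-- every a₂ᵏ in a⊥¹, and 2-frames (a⊥ᵏ, a₁¹ + a⊥ᵏ, a₂ᵏ, c₁₂ᵏ).  The projecting terms push the
-- generators through eight term operations, each enforcing one more clause of normality while
-- fixing normal assignments.  Two modular-lattice facts do the work: joining
-- w + (w + z)y to x, y, z makes them meet pairwise in that element once x·y, x·z ≤ w ≤ x
-- (pairwiseMeet-lift), and cutting x down to j and y, z to (j + z)y, (j + y)z turns a pairwise
-- meeting triple into a frame (frame-restrict).

module Submission where

open import Level using (Level)
open import Data.Nat using (ℕ; zero; suc)
open import Data.Fin using (Fin; fromℕ; inject₁) renaming (zero to fzero; suc to fsuc)
open import Data.Fin.Induction using (<-weakInduction; >-weakInduction)
open import Function using (_∘_)
open import Data.Product using (_×_; _,_; proj₁; proj₂)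
open import Data.List using (List; []; _∷_; tabulate; concatMap; allFin)
open import Data.List.Relation.Unary.All using (All; []; _∷_; head; tail) renaming (map to All-map)
open import Data.List.Relation.Unary.All.Properties
  using (tabulate⁺; tabulate⁻; map⁺; map⁻; concat⁺; concat⁻; ++⁺; ++⁻ˡ; ++⁻ʳ)
import Data.Vec as Vec
import Algebra.Lattice.Properties.Lattice as AlgebraicLattice
import Relation.Binary.Lattice as OrderLattice
import Relation.Binary.Lattice.Properties.JoinSemilattice as JoinSemilattice
import Relation.Binary.Lattice.Properties.MeetSemilattice as MeetSemilattice
import Relation.Binary.Reasoning.PartialOrder as ≤-Reasoning
open import Defs

module ModularLatticeProperties {c ℓ : Level} (L : ModularLattice c ℓ) where

  open ModularLattice L public
  open AlgebraicLattice lattice using (poset; ∨-∧-orderTheoreticLattice)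
  open OrderLattice.Lattice ∨-∧-orderTheoreticLattice public
    using (_≤_; ∨-least; ∧-greatest; joinSemilattice; meetSemilattice)
    renaming (refl to ≤-refl; trans to ≤-trans; reflexive to ≤-reflexive; antisym to ≤-antisym)
  open OrderLattice.Lattice ∨-∧-orderTheoreticLattice using (x≤x∨y; y≤x∨y; x∧y≤x; x∧y≤y)
  open JoinSemilattice joinSemilattice public using (∨-monotonic)
  open MeetSemilattice meetSemilattice public using (∧-monotonic)
  open ≤-Reasoning poset public using (begin_; _∎; step-≤)

  private variable
    b e j o p q s t w x y z x′ y′ z′ o′ : Carrier

  infixr 5 _⨾_
  _⨾_ : x ≤ y → y ≤ z → x ≤ z
  _⨾_ = ≤-trans

  ≤∨ˡ : x ≤ x ∨ y
  ≤∨ˡ = x≤x∨y _ _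

  ≤∨ʳ : y ≤ x ∨ y
  ≤∨ʳ = y≤x∨y _ _

  ∧≤ˡ : x ∧ y ≤ x
  ∧≤ˡ = x∧y≤x _ _

  ∧≤ʳ : x ∧ y ≤ y
  ∧≤ʳ = x∧y≤y _ _

  ∨-comm-≤ : x ∨ y ≤ y ∨ x
  ∨-comm-≤ = ∨-least ≤∨ʳ ≤∨ˡ

  ∧-comm-≤ : x ∧ y ≤ y ∧ x
  ∧-comm-≤ = ∧-greatest ∧≤ʳ ∧≤ˡ

  modular-≤ : x ≤ z → (x ∨ y) ∧ z ≤ x ∨ (y ∧ z)
  modular-≤ {x} {z} {y} x≤z = ≤-reflexive (sym (modular x y z x≤z))

  ≤-cong : x ≈ x′ → y ≈ y′ → x ≤ y → x′ ≤ y′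
  ≤-cong x≈ y≈ x≤y = ≤-reflexive (sym x≈) ⨾ x≤y ⨾ ≤-reflexive y≈

  ∨-assoc-≤ : x ∨ (y ∨ z) ≤ (x ∨ y) ∨ z
  ∨-assoc-≤ = ∨-least (≤∨ˡ ⨾ ≤∨ˡ) (∨-monotonic ≤∨ʳ ≤-refl)

  y≤x⇒x∨y≈x : y ≤ x → x ∨ y ≈ x
  y≤x⇒x∨y≈x y≤x = ≤-antisym (∨-least ≤-refl y≤x) ≤∨ˡ

  record PairwiseMeet (o x y z : Carrier) : Set ℓ where
    field
      o≤x : o ≤ x
      o≤y : o ≤ y
      o≤z : o ≤ z
      x∧y≤o : x ∧ y ≤ o
      x∧z≤o : x ∧ z ≤ o
      y∧z≤o : y ∧ z ≤ o

  record Frame (o x y z : Carrier) : Set ℓ where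
    field
      pairwiseMeet : PairwiseMeet o x y z
      x≤y∨z : x ≤ y ∨ z
      y≤x∨z : y ≤ x ∨ z
      z≤x∨y : z ≤ x ∨ y
    open PairwiseMeet pairwiseMeet public

  pairwiseMeet-narrow : PairwiseMeet o x y z → o ≤ o′ → x′ ≤ x → y′ ≤ y → z′ ≤ z →
                        o′ ≤ x′ → o′ ≤ y′ → o′ ≤ z′ → PairwiseMeet o′ x′ y′ z′
  pairwiseMeet-narrow M o≤o′ x′≤x y′≤y z′≤z o′≤x′ o′≤y′ o′≤z′ = record
    { o≤x = o′≤x′ ; o≤y = o′≤y′ ; o≤z = o′≤z′
    ; x∧y≤o = ∧-monotonic x′≤x y′≤y ⨾ x∧y≤o ⨾ o≤o′
    ; x∧z≤o = ∧-monotonic x′≤x z′≤z ⨾ x∧z≤o ⨾ o≤o′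
    ; y∧z≤o = ∧-monotonic y′≤y z′≤z ⨾ y∧z≤o ⨾ o≤o′
    }
    where open PairwiseMeet M

  frame-cong : o ≈ o′ → x ≈ x′ → y ≈ y′ → z ≈ z′ → Frame o x y z → Frame o′ x′ y′ z′
  frame-cong o≈ x≈ y≈ z≈ F = record
    { pairwiseMeet = pairwiseMeet-narrow pairwiseMeet (≤-reflexive o≈)
        (≤-reflexive (sym x≈)) (≤-reflexive (sym y≈)) (≤-reflexive (sym z≈))
        (≤-cong o≈ x≈ o≤x) (≤-cong o≈ y≈ o≤y) (≤-cong o≈ z≈ o≤z)
    ; x≤y∨z = ≤-cong x≈ (∨-cong y≈ z≈) x≤y∨z
    ; y≤x∨z = ≤-cong y≈ (∨-cong x≈ z≈) y≤x∨z
    ; z≤x∨y = ≤-cong z≈ (∨-cong x≈ y≈) z≤x∨y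
    }
    where open Frame F

  lift : Carrier → Carrier → Carrier → Carrier
  lift w y z = w ∨ ((w ∨ z) ∧ y)

  pairwiseMeet-lift : w ≤ x → x ∧ y ≤ w → x ∧ z ≤ w →
                      PairwiseMeet (lift w y z) (x ∨ lift w y z) (y ∨ lift w y z) (z ∨ lift w y z)
  pairwiseMeet-lift {w} {x} {y} {z} w≤x x∧y≤w x∧z≤w = record
    { o≤x = ≤∨ʳ ; o≤y = ≤∨ʳ ; o≤z = ≤∨ʳ ; x∧y≤o = x∨σ∧y∨σ ; x∧z≤o = x∨σ∧z∨σ ; y∧z≤o = y∨σ∧z∨σ }
    where
    φ = (w ∨ z) ∧ y
    σ = w ∨ φ
    x∨σ∧y∨σ : (x ∨ σ) ∧ (y ∨ σ) ≤ σ
    x∨σ∧y∨σ = begin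
      (x ∨ σ) ∧ (y ∨ σ) ≤⟨ ∧-comm-≤ ⟩
      (y ∨ σ) ∧ (x ∨ σ) ≤⟨ ∧-monotonic (∨-least ≤∨ʳ (∨-least ≤∨ˡ (∧≤ʳ ⨾ ≤∨ʳ)))
                                       (∨-least ≤∨ˡ (∨-least (w≤x ⨾ ≤∨ˡ) ≤∨ʳ)) ⟩
      (w ∨ y) ∧ (x ∨ φ) ≤⟨ modular-≤ (w≤x ⨾ ≤∨ˡ) ⟩
      w ∨ (y ∧ (x ∨ φ)) ≤⟨ ∨-monotonic ≤-refl (∧-comm-≤ ⨾ ∧-monotonic ∨-comm-≤ ≤-refl) ⟩
      w ∨ ((φ ∨ x) ∧ y) ≤⟨ ∨-monotonic ≤-refl (modular-≤ ∧≤ʳ) ⟩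
      w ∨ (φ ∨ (x ∧ y)) ≤⟨ ∨-least ≤∨ˡ (∨-least ≤∨ʳ (x∧y≤w ⨾ ≤∨ˡ)) ⟩
      σ ∎
    x∨σ∧z∨σ : (x ∨ σ) ∧ (z ∨ σ) ≤ σ
    x∨σ∧z∨σ = begin
      (x ∨ σ) ∧ (z ∨ σ) ≤⟨ ∧-monotonic (∨-least ≤∨ʳ (∨-least (w≤x ⨾ ≤∨ʳ) ≤∨ˡ))
                                       (∨-least ≤∨ˡ (∨-least ≤∨ʳ (∧≤ˡ ⨾ ∨-comm-≤))) ⟩
      (φ ∨ x) ∧ (z ∨ w) ≤⟨ modular-≤ (∧≤ˡ ⨾ ∨-comm-≤) ⟩
      φ ∨ (x ∧ (z ∨ w)) ≤⟨ ∨-monotonic ≤-refl (∧-comm-≤ ⨾ ∧-monotonic ∨-comm-≤ ≤-refl) ⟩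
      φ ∨ ((w ∨ z) ∧ x) ≤⟨ ∨-monotonic ≤-refl (modular-≤ w≤x) ⟩
      φ ∨ (w ∨ (z ∧ x)) ≤⟨ ∨-least ≤∨ʳ (∨-least ≤∨ˡ (∧-comm-≤ ⨾ x∧z≤w ⨾ ≤∨ˡ)) ⟩
      σ ∎
    y∨σ∧z∨σ : (y ∨ σ) ∧ (z ∨ σ) ≤ σ
    y∨σ∧z∨σ = begin
      (y ∨ σ) ∧ (z ∨ σ) ≤⟨ ∧-monotonic (∨-least ≤∨ʳ (∨-least ≤∨ˡ (∧≤ʳ ⨾ ≤∨ʳ)))
                                       (∨-least ≤∨ʳ (∨-least ≤∨ˡ ∧≤ˡ)) ⟩
      (w ∨ y) ∧ (w ∨ z) ≤⟨ modular-≤ ≤∨ˡ ⟩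
      w ∨ (y ∧ (w ∨ z)) ≤⟨ ∨-monotonic ≤-refl ∧-comm-≤ ⟩
      σ ∎

  ∧-∨-independent : p ≤ t → q ≤ t → s ≤ q → e ∧ t ≤ s → p ∧ q ≤ s → (p ∨ e) ∧ (q ∨ e) ≤ s ∨ e
  ∧-∨-independent {p} {t} {q} {s} {e} p≤t q≤t s≤q e∧t≤s p∧q≤s = begin
    (p ∨ e) ∧ (q ∨ e)       ≤⟨ ∧-comm-≤ ⨾ ∧-monotonic ∨-comm-≤ ≤-refl ⟩
    (e ∨ q) ∧ (p ∨ e)       ≤⟨ modular-≤ ≤∨ʳ ⟩
    e ∨ (q ∧ (p ∨ e))       ≤⟨ ∨-monotonic ≤-refl (∧-greatest ∧≤ˡ (∧-greatest (∧≤ˡ ⨾ q≤t) ∧≤ʳ)) ⟩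
    e ∨ (q ∧ (t ∧ (p ∨ e))) ≤⟨ ∨-monotonic ≤-refl (∧-monotonic ≤-refl (∧-comm-≤ ⨾ modular-≤ p≤t)) ⟩
    e ∨ (q ∧ (p ∨ (e ∧ t))) ≤⟨ ∨-monotonic ≤-refl (∧-monotonic ≤-refl (∨-monotonic ≤-refl e∧t≤s)) ⟩
    e ∨ (q ∧ (p ∨ s))       ≤⟨ ∨-monotonic ≤-refl (∧-comm-≤ ⨾ ∧-monotonic ∨-comm-≤ ≤-refl) ⟩
    e ∨ ((s ∨ p) ∧ q)       ≤⟨ ∨-monotonic ≤-refl (modular-≤ s≤q) ⟩
    e ∨ (s ∨ (p ∧ q))       ≤⟨ ∨-least ≤∨ʳ (∨-least ≤∨ˡ (p∧q≤s ⨾ ≤∨ˡ)) ⟩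
    s ∨ e                   ∎

  pairwiseMeet-∨ : PairwiseMeet s x y z → x ≤ t → y ≤ t → z ≤ t → e ∧ t ≤ s →
                   PairwiseMeet (s ∨ e) (x ∨ e) (y ∨ e) (z ∨ e)
  pairwiseMeet-∨ M x≤t y≤t z≤t e∧t≤s = record
    { o≤x = ∨-monotonic o≤x ≤-refl ; o≤y = ∨-monotonic o≤y ≤-refl ; o≤z = ∨-monotonic o≤z ≤-refl
    ; x∧y≤o = ∧-∨-independent x≤t y≤t o≤y e∧t≤s x∧y≤o
    ; x∧z≤o = ∧-∨-independent x≤t z≤t o≤z e∧t≤s x∧z≤o
    ; y∧z≤o = ∧-∨-independent y≤t z≤t o≤z e∧t≤s y∧z≤o
    }
    where open PairwiseMeet M

  frame-raise : Frame o x y z → PairwiseMeet o′ (x ∨ e) (y ∨ e) (z ∨ e) → Frame o′ (x ∨ e) (y ∨ e) (z ∨ e)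
  frame-raise F M = record
    { pairwiseMeet = M
    ; x≤y∨z = ∨-least (x≤y∨z ⨾ ∨-monotonic ≤∨ˡ ≤∨ˡ) (≤∨ʳ ⨾ ≤∨ˡ)
    ; y≤x∨z = ∨-least (y≤x∨z ⨾ ∨-monotonic ≤∨ˡ ≤∨ˡ) (≤∨ʳ ⨾ ≤∨ˡ)
    ; z≤x∨y = ∨-least (z≤x∨y ⨾ ∨-monotonic ≤∨ˡ ≤∨ˡ) (≤∨ʳ ⨾ ≤∨ˡ)
    }
    where open Frame F

  frame-∨ : Frame s x y z → x ≤ t → y ≤ t → z ≤ t → e ∧ t ≤ s → s ≤ e →
            Frame e (x ∨ e) (y ∨ e) (z ∨ e)
  frame-∨ F x≤t y≤t z≤t e∧t≤s s≤e = frame-raise F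
    (pairwiseMeet-narrow (pairwiseMeet-∨ (Frame.pairwiseMeet F) x≤t y≤t z≤t e∧t≤s)
       (∨-least s≤e ≤-refl) ≤-refl ≤-refl ≤-refl ≤∨ʳ ≤∨ʳ ≤∨ʳ)

  frame-restrict : PairwiseMeet o x y z → o ≤ j → j ≤ x → j ≤ y ∨ z →
                   Frame o j ((j ∨ z) ∧ y) ((j ∨ y) ∧ z)
  frame-restrict {o} {x} {y} {z} {j} M o≤j j≤x j≤y∨z = record
    { pairwiseMeet = record
      { o≤x = o≤j
      ; o≤y = ∧-greatest (o≤j ⨾ ≤∨ˡ) o≤y
      ; o≤z = ∧-greatest (o≤j ⨾ ≤∨ˡ) o≤z
      ; x∧y≤o = ∧-monotonic j≤x ∧≤ʳ ⨾ x∧y≤o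
      ; x∧z≤o = ∧-monotonic j≤x ∧≤ʳ ⨾ x∧z≤o
      ; y∧z≤o = ∧-monotonic ∧≤ʳ ∧≤ʳ ⨾ y∧z≤o
      }
    ; x≤y∨z = j≤ŷ∨ẑ
    ; y≤x∨z = ∧-greatest ∧≤ˡ (∧≤ʳ ⨾ ≤∨ʳ) ⨾ modular-≤ ≤∨ˡ ⨾ ∨-monotonic ≤-refl ∧-comm-≤
    ; z≤x∨y = ∧-greatest ∧≤ˡ (∧≤ʳ ⨾ ≤∨ʳ) ⨾ modular-≤ ≤∨ˡ ⨾ ∨-monotonic ≤-refl ∧-comm-≤
    }
    where
    open PairwiseMeet M
    ŷ = (j ∨ z) ∧ y
    ẑ = (j ∨ y) ∧ z
    j≤ŷ∨ẑ : j ≤ ŷ ∨ ẑ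
    j≤ŷ∨ẑ = begin
      j                           ≤⟨ ∧-greatest ≤∨ˡ ≤∨ˡ ⟩
      (j ∨ z) ∧ (j ∨ y)           ≤⟨ ∧-monotonic (∧-greatest (∨-least (j≤y∨z ⨾ ∨-comm-≤) ≤∨ˡ) ≤-refl) ≤-refl ⟩
      ((z ∨ y) ∧ (j ∨ z)) ∧ (j ∨ y) ≤⟨ ∧-monotonic (modular-≤ ≤∨ʳ ⨾ ∨-least ≤∨ʳ (∧-comm-≤ ⨾ ≤∨ˡ)) ≤-refl ⟩
      (ŷ ∨ z) ∧ (j ∨ y)          ≤⟨ modular-≤ (∧≤ʳ ⨾ ≤∨ʳ) ⟩
      ŷ ∨ (z ∧ (j ∨ y))          ≤⟨ ∨-monotonic ≤-refl ∧-comm-≤ ⟩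
      ŷ ∨ ẑ                     ∎

  frame-restrict-id : Frame o x y z → x ≤ j → ((j ∨ z) ∧ y ≈ y) × ((j ∨ y) ∧ z ≈ z)
  frame-restrict-id F x≤j =
    ≤-antisym ∧≤ʳ (∧-greatest (y≤x∨z ⨾ ∨-monotonic x≤j ≤-refl) ≤-refl) ,
    ≤-antisym ∧≤ʳ (∧-greatest (z≤x∨y ⨾ ∨-monotonic x≤j ≤-refl) ≤-refl)
    where open Frame F

  independence-exchange : b ≤ x → x ∧ p ≤ b → (x ∨ p) ∧ y ≤ b → p ∧ (x ∨ y) ≤ b
  independence-exchange {b} {x} {p} {y} b≤x x∧p≤b x∨p∧y≤b = begin
    p ∧ (x ∨ y)               ≤⟨ ∧-greatest ∧≤ˡ (∧-greatest (∧≤ˡ ⨾ ≤∨ʳ) ∧≤ʳ) ⟩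
    p ∧ ((x ∨ p) ∧ (x ∨ y))   ≤⟨ ∧-monotonic ≤-refl (∧-comm-≤ ⨾ modular-≤ ≤∨ˡ) ⟩
    p ∧ (x ∨ (y ∧ (x ∨ p)))   ≤⟨ ∧-monotonic ≤-refl (∨-least ≤-refl (∧-comm-≤ ⨾ x∨p∧y≤b ⨾ b≤x)) ⟩
    p ∧ x                     ≤⟨ ∧-comm-≤ ⨾ x∧p≤b ⟩
    b                         ∎

module Evaluation {c ℓ : Level} (L : ModularLattice c ℓ) {G : Set} (e : G → ModularLattice.Carrier L) where

  open ModularLatticeProperties L

  ev : Term G → Carrier
  ev t = ⟦ t ⟧ L e

  private variable
    u : Carrier
    t x₁ x₂ y₁ y₂ : Term G
    ts : List (Term G)

  ⋁-upper : All (λ s → ev s ≤ ev (⋁ t ts)) (t ∷ ts)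
  ⋁-upper {ts = []}     = ≤-refl ∷ []
  ⋁-upper {ts = _ ∷ _} = ≤∨ˡ ∷ All-map (_⨾ ≤∨ʳ) ⋁-upper

  ⋁-least : All (λ s → ev s ≤ u) (t ∷ ts) → ev (⋁ t ts) ≤ u
  ⋁-least {ts = []}     (p ∷ []) = p
  ⋁-least {ts = _ ∷ _} (p ∷ ps) = ∨-least p (⋁-least ps)

  ⋀-lower : All (λ s → ev (⋀ t ts) ≤ ev s) (t ∷ ts)
  ⋀-lower {ts = []}     = ≤-refl ∷ []
  ⋀-lower {ts = _ ∷ _} = ∧≤ˡ ∷ All-map (∧≤ʳ ⨾_) ⋀-lower

  ⋀-greatest : All (λ s → u ≤ ev s) (t ∷ ts) → u ≤ ev (⋀ t ts)
  ⋀-greatest {ts = []}     (p ∷ []) = p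
  ⋀-greatest {ts = _ ∷ _} (p ∷ ps) = ∧-greatest p (⋀-greatest ps)

  frame2⁺ : ∀ {o x y z} → Frame (ev o) (ev x) (ev y) (ev z) → IsModel (frame2 o x y z) L e
  frame2⁺ F =
    ≤-antisym (∧-greatest o≤y o≤x) (∧-comm-≤ ⨾ x∧y≤o) ∷
    ≤-antisym (∧-greatest o≤x o≤z) x∧z≤o ∷
    ≤-antisym (x∧z≤o ⨾ ∧-greatest o≤y o≤z) (y∧z≤o ⨾ ∧-greatest o≤x o≤z) ∷
    ≤-antisym (∨-least ≤∨ˡ y≤x∨z) (∨-least ≤∨ˡ z≤x∨y) ∷
    ≤-antisym (∨-least x≤y∨z ≤∨ʳ) (∨-least y≤x∨z ≤∨ʳ) ∷ []
    where open Frame F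

  frame2⁻ : ∀ {o x y z} → IsModel (frame2 o x y z) L e → Frame (ev o) (ev x) (ev y) (ev z)
  frame2⁻ (o≈y∧x ∷ o≈x∧z ∷ x∧z≈y∧z ∷ x∨y≈x∨z ∷ x∨z≈y∨z ∷ []) = record
    { pairwiseMeet = record
      { o≤x = ≤-reflexive o≈y∧x ⨾ ∧≤ʳ
      ; o≤y = ≤-reflexive o≈y∧x ⨾ ∧≤ˡ
      ; o≤z = ≤-reflexive o≈x∧z ⨾ ∧≤ʳ
      ; x∧y≤o = ∧-comm-≤ ⨾ ≤-reflexive (sym o≈y∧x)
      ; x∧z≤o = ≤-reflexive (sym o≈x∧z)
      ; y∧z≤o = ≤-reflexive (sym x∧z≈y∧z) ⨾ ≤-reflexive (sym o≈x∧z)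
      }
    ; x≤y∨z = ≤∨ˡ ⨾ ≤-reflexive x∨z≈y∨z
    ; y≤x∨z = ≤∨ʳ ⨾ ≤-reflexive x∨y≈x∨z
    ; z≤x∨y = ≤∨ʳ ⨾ ≤-reflexive (sym x∨y≈x∨z)
    }

  ↗-pair⁺ : ev x₂ ≤ ev x₁ → ev x₁ ≤ ev y₁ → ev x₂ ≤ ev y₂ → ev y₂ ≤ ev y₁ →
            ev y₁ ≤ ev x₁ ∨ ev y₂ → ev y₂ ∧ ev x₁ ≤ ev x₂ →
            IsModel (↗ (x₁ Vec.∷ x₂ Vec.∷ Vec.[]) (y₁ Vec.∷ y₂ Vec.∷ Vec.[])) L e
  ↗-pair⁺ x₂≤x₁ x₁≤y₁ x₂≤y₂ y₂≤y₁ y₁≤x₁∨y₂ y₂∧x₁≤x₂ =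
    ≤-antisym (y₁≤x₁∨y₂ ⨾ ∨-monotonic ≤-refl (∧-greatest y₂≤y₁ ≤-refl)) (∨-least x₁≤y₁ ∧≤ˡ) ∷
    ≤-antisym (∧-greatest x₁≤y₁ ≤∨ˡ) (∧≤ʳ ⨾ ∨-least ≤-refl x₂≤x₁) ∷
    ≤-antisym (∧-greatest y₂≤y₁ ≤-refl ⨾ ≤∨ʳ) (∨-least x₂≤y₂ ∧≤ʳ) ∷
    ≤-antisym (∧-greatest x₂≤y₂ ≤∨ʳ) (∧-monotonic ≤-refl (∨-least ≤-refl x₂≤x₁) ⨾ y₂∧x₁≤x₂) ∷ []

  ↗-pair⁻ : IsModel (↗ (x₁ Vec.∷ x₂ Vec.∷ Vec.[]) (y₁ Vec.∷ y₂ Vec.∷ Vec.[])) L e →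
            (ev y₁ ≈ ev x₁ ∨ (ev y₁ ∧ ev y₂)) × (ev x₂ ≤ ev y₂) × (ev y₂ ∧ (ev x₁ ∨ ev x₂) ≤ ev x₂)
  ↗-pair⁻ (y₁≈ ∷ _ ∷ y₂≈ ∷ x₂≈ ∷ []) = y₁≈ , ≤∨ˡ ⨾ ≤-reflexive (sym y₂≈) , ≤-reflexive (sym x₂≈)

module _ {p} {A : Set} {P : A → Set p} {n : ℕ} {f : Fin n → List A} where

  All-concatMap⁺ : (∀ i → All P (f i)) → All P (concatMap f (allFin n))
  All-concatMap⁺ h = concat⁺ (map⁺ (tabulate⁺ {f = λ i → i} h))

  All-concatMap⁻ : All P (concatMap f (allFin n)) → ∀ i → All P (f i)
  All-concatMap⁻ h = tabulate⁻ {f = λ i → i} (map⁻ (concat⁻ h))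

module Construction (m : ℕ) where

  G : Set
  G = Gen3 (suc m)

  T : Set
  T = Term G

  -- b, X, A, C stand for a⊥¹, a₁¹, a₃, c₁₃ and o k, y k, z k for a⊥ᵏ, a₂ᵏ, c₁₂ᵏ;
  -- a₁ᵏ is represented by X ∨ o k (see output).
  record State {a} (E : Set a) : Set a where
    field
      b X A C : E
      o y z : Fin (suc m) → E

  open State public

  ⋁ᶠ : (Fin (suc m) → T) → T
  ⋁ᶠ f = ⋁ (f fzero) (tabulate f)

  ⋀ᶠ : (Fin (suc m) → T) → T
  ⋀ᶠ f = ⋀ (f fzero) (tabulate f)

  liftᵗ : T → T → T → T
  liftᵗ w y z = w ⊕ ((w ⊕ z) ⊙ y)

  spanᵗ : State T → T
  spanᵗ S = (X S ⊕ A S) ⊕ C S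

  ascendChain : ∀ k → T → (Fin (suc k) → T) → (Fin (suc k) → T) → Fin (suc k) → T × T
  ascendChain k       t os ys fzero    = t ⊕ os fzero , (t ⊕ os fzero) ⊕ ys fzero
  ascendChain (suc k) t os ys (fsuc i) =
    ascendChain k ((t ⊕ os fzero) ⊕ ys fzero) (os ∘ fsuc) (ys ∘ fsuc) i

  ascend : State T → State T
  ascend S = record S
    { X = X S ⊕ b S ; A = A S ⊕ b S ; C = C S ⊕ b S
    ; o = proj₁ ∘ ascendChain m (b S) (o S) (y S)
    ; y = proj₂ ∘ ascendChain m (b S) (o S) (y S)
    }

  raise : T → State T → State T
  raise s S = record S
    { b = b S ⊕ s ; X = X S ⊕ s ; A = A S ⊕ s ; C = C S ⊕ s
    ; o = λ i → o S i ⊕ s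
    ; y = λ i → y S i ⊕ s
    }

  separate : State T → State T
  separate S = raise (spanᵗ S ⊙ y S (fromℕ m)) S

  separateXA : State T → State T
  separateXA S = raise (X S ⊙ A S) S

  meetBase : State T → State T
  meetBase S = raise (liftᵗ (C S ⊙ X S) (A S) (C S)) S

  restrictBase : T → State T → State T
  restrictBase J S = record S { X = J ; A = (J ⊕ C S) ⊙ A S ; C = (J ⊕ A S) ⊙ C S }

  frameBase : State T → State T
  frameBase S = restrictBase (X S ⊙ (A S ⊕ C S)) S

  boundLevels : State T → State T
  boundLevels S = record S { z = λ i → (z S i ⊕ o S i) ⊙ (X S ⊕ y S i) }

  -- w contains every z i ∧ X, which is what pairwiseMeet-lift needs at each level.
  module LevelLift (S : State T) where
    w : T
    w = b S ⊕ ⋁ᶠ (λ i → z S i ⊙ X S)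
    w₃ : T
    w₃ = (w ⊕ C S) ⊙ A S
    W : T
    W = w ⊕ w₃
    σ : Fin (suc m) → T
    σ i = liftᵗ (w ⊕ o S i) (y S i) (z S i) ⊕ w₃

  meetLevels : State T → State T
  meetLevels S = record
    { b = W ; X = X S ⊕ W ; A = A S ⊕ W ; C = C S ⊕ W
    ; o = σ
    ; y = λ i → y S i ⊕ σ i
    ; z = λ i → z S i ⊕ σ i
    }
    where open LevelLift S

  coreX : State T → T
  coreX S = X S ⊙ ⋀ᶠ (λ i → y S i ⊕ z S i)

  frameLevels : State T → State T
  frameLevels S = record (restrictBase J S)
    { y = λ i → ((J ⊕ o S i) ⊕ z S i) ⊙ y S i
    ; z = λ i → ((J ⊕ o S i) ⊕ y S i) ⊙ z S i
    }
    where J = coreX S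

  normalize : State T → State T
  normalize = frameLevels ∘ meetLevels ∘ boundLevels ∘ frameBase ∘ meetBase ∘ separateXA ∘ separate ∘ ascend

  input : State T
  input = record
    { b = var (a⊥ fzero) ; X = var (a₁ fzero) ; A = var a₃ ; C = var c₁₃
    ; o = var ∘ a⊥ ; y = var ∘ a₂ ; z = var ∘ c₁₂
    }

  towerFrame : Fin (suc m) → Presentation G
  towerFrame k = frame2 (var (a⊥ k)) (var (a₁ k)) (var (a₂ k)) (var (c₁₂ k))

  towerStep : Fin m → Presentation G
  towerStep k = ↗ (var (a₁ (inject₁ k)) ⊕ var (a₂ (inject₁ k)) Vec.∷ var (a₂ (inject₁ k)) Vec.∷ Vec.[])
                  (var (a₁ (fsuc k)) Vec.∷ var (a⊥ (fsuc k)) Vec.∷ Vec.[])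

  generators : Fin (suc m) → List T
  generators k = var (a⊥ k) ∷ var (a₁ k) ∷ var (a₂ k) ∷ var (c₁₂ k) ∷ []

  output : State T → G → T
  output S (a⊥ k)  = o S k
  output S (a₁ k)  = X S ⊕ o S k
  output S (a₂ k)  = y S k
  output S (c₁₂ k) = z S k
  output S a₃      = A S ⊕ o S fzero
  output S c₁₃     = C S ⊕ o S fzero

module Normality {c ℓ : Level} (L : ModularLattice c ℓ) (m : ℕ) where

  open ModularLatticeProperties L
  open Construction m using (State; b; X; A; C; o; y; z)

  record Chain (b₀ : Carrier) (o y : Fin (suc m) → Carrier) : Set ℓ where
    field
      b≤o₀ : b₀ ≤ o fzero
      o≤y  : ∀ i → o i ≤ y i
      y≤o  : ∀ (j : Fin m) → y (inject₁ j) ≤ o (fsuc j)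

    b≤o : ∀ i → b₀ ≤ o i
    b≤o = <-weakInduction (λ i → b₀ ≤ o i) b≤o₀ (λ j b≤oⱼ → b≤oⱼ ⨾ o≤y (inject₁ j) ⨾ y≤o j)

    b≤y : ∀ i → b₀ ≤ y i
    b≤y i = b≤o i ⨾ o≤y i

    y≤top : ∀ i → y i ≤ y (fromℕ m)
    y≤top = >-weakInduction (λ i → y i ≤ y (fromℕ m)) ≤-refl (λ j yⱼ₊₁≤top → y≤o j ⨾ o≤y (fsuc j) ⨾ yⱼ₊₁≤top)

  span : State Carrier → Carrier
  span S = (X S ∨ A S) ∨ C S

  span-raise : ∀ S {s} → s ≤ span S → ((X S ∨ s) ∨ (A S ∨ s)) ∨ (C S ∨ s) ≤ span S
  span-raise S s≤span =
    ∨-least (∨-least (∨-least (≤∨ˡ ⨾ ≤∨ˡ) s≤span) (∨-least (≤∨ʳ ⨾ ≤∨ˡ) s≤span)) (∨-least ≤∨ʳ s≤span)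

  record Ascending (S : State Carrier) : Set ℓ where
    field
      chain : Chain (b S) (o S) (y S)
      b≤X : b S ≤ X S
      b≤A : b S ≤ A S
      b≤C : b S ≤ C S
    open Chain chain public

  record Separated (S : State Carrier) : Set ℓ where
    field
      ascending   : Ascending S
      independent : ∀ i → span S ∧ y S i ≤ b S
    open Ascending ascending public

  separated-restrict : ∀ S {X′ A′ C′ : Carrier} {y′ z′ : Fin (suc m) → Carrier} →
                       Separated S → PairwiseMeet (b S) X′ A′ C′ → X′ ≤ X S → A′ ≤ A S → C′ ≤ C S →
                       (∀ i → o S i ≤ y′ i) → (∀ i → y′ i ≤ y S i) →
                       Separated (record S { X = X′ ; A = A′ ; C = C′ ; y = y′ ; z = z′ })
  separated-restrict S sep M X′≤X A′≤A C′≤C o≤y′ y′≤y = record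
    { ascending = record
      { chain = record { b≤o₀ = b≤o₀ ; o≤y = o≤y′ ; y≤o = λ j → y′≤y (inject₁ j) ⨾ y≤o j }
      ; b≤X = o≤x ; b≤A = o≤y ; b≤C = o≤z
      }
    ; independent = λ i → ∧-monotonic (∨-monotonic (∨-monotonic X′≤X A′≤A) C′≤C) (y′≤y i) ⨾ independent i
    }
    where
    open Separated sep using (b≤o₀; y≤o; independent)
    open PairwiseMeet M

  BaseMeets : State Carrier → Set ℓ
  BaseMeets S = PairwiseMeet (b S) (X S) (A S) (C S)

  BaseFrame : State Carrier → Set ℓ
  BaseFrame S = Frame (b S) (X S) (A S) (C S)

  LevelMeets : State Carrier → Fin (suc m) → Set ℓ
  LevelMeets S i = PairwiseMeet (o S i) (X S ∨ o S i) (y S i) (z S i)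

  LevelFrame : State Carrier → Fin (suc m) → Set ℓ
  LevelFrame S i = Frame (o S i) (X S ∨ o S i) (y S i) (z S i)

  record Normal (S : State Carrier) : Set ℓ where
    field
      separated  : Separated S
      baseFrame  : BaseFrame S
      levelFrame : ∀ i → LevelFrame S i
    open Separated separated public

  record _≋_ (S S′ : State Carrier) : Set ℓ where
    field
      b≈ : b S ≈ b S′
      X≈ : X S ≈ X S′
      A≈ : A S ≈ A S′
      C≈ : C S ≈ C S′
      o≈ : ∀ i → o S i ≈ o S′ i
      y≈ : ∀ i → y S i ≈ y S′ i
      z≈ : ∀ i → z S i ≈ z S′ i

  ≋-sym : ∀ {S S′} → S ≋ S′ → S′ ≋ S
  ≋-sym E = record
    { b≈ = sym b≈ ; X≈ = sym X≈ ; A≈ = sym A≈ ; C≈ = sym C≈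
    ; o≈ = sym ∘ o≈ ; y≈ = sym ∘ y≈ ; z≈ = sym ∘ z≈ }
    where open _≋_ E

  ≋-trans : ∀ {S S′ S″} → S ≋ S′ → S′ ≋ S″ → S ≋ S″
  ≋-trans E E′ = record
    { b≈ = trans E.b≈ E′.b≈ ; X≈ = trans E.X≈ E′.X≈ ; A≈ = trans E.A≈ E′.A≈ ; C≈ = trans E.C≈ E′.C≈
    ; o≈ = λ i → trans (E.o≈ i) (E′.o≈ i)
    ; y≈ = λ i → trans (E.y≈ i) (E′.y≈ i)
    ; z≈ = λ i → trans (E.z≈ i) (E′.z≈ i)
    }
    where
    module E = _≋_ E
    module E′ = _≋_ E′

  normal-cong : ∀ {S S′} → S ≋ S′ → Normal S → Normal S′
  normal-cong E N = record
    { separated = record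
      { ascending = record
        { chain = record
          { b≤o₀ = ≤-cong b≈ (o≈ fzero) b≤o₀
          ; o≤y  = λ i → ≤-cong (o≈ i) (y≈ i) (o≤y i)
          ; y≤o  = λ j → ≤-cong (y≈ (inject₁ j)) (o≈ (fsuc j)) (y≤o j)
          }
        ; b≤X = ≤-cong b≈ X≈ b≤X
        ; b≤A = ≤-cong b≈ A≈ b≤A
        ; b≤C = ≤-cong b≈ C≈ b≤C
        }
      ; independent = λ i → ≤-cong (∧-cong (∨-cong (∨-cong X≈ A≈) C≈) (y≈ i)) b≈ (independent i)
      }
    ; baseFrame  = frame-cong b≈ X≈ A≈ C≈ baseFrame
    ; levelFrame = λ i → frame-cong (o≈ i) (∨-cong X≈ (o≈ i)) (y≈ i) (z≈ i) (levelFrame i)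
    }
    where
    open _≋_ E
    open Normal N

module Steps {c ℓ : Level} (L : ModularLattice c ℓ) (m : ℕ)
             (a : Gen3 (suc m) → ModularLattice.Carrier L) where

  open ModularLatticeProperties L
  open Construction m
  open Normality L m
  open Evaluation L a

  ⟦_⟧ˢ : State T → State Carrier
  ⟦ S ⟧ˢ = record
    { b = ev (b S) ; X = ev (X S) ; A = ev (A S) ; C = ev (C S)
    ; o = λ i → ev (o S i) ; y = λ i → ev (y S i) ; z = λ i → ev (z S i)
    }

  ⋁ᶠ-upper : ∀ f i → ev (f i) ≤ ev (⋁ᶠ f)
  ⋁ᶠ-upper f = tabulate⁻ {f = f} (tail (⋁-upper {t = f fzero} {ts = tabulate f}))

  ⋁ᶠ-least : ∀ f {u} → (∀ i → ev (f i) ≤ u) → ev (⋁ᶠ f) ≤ u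
  ⋁ᶠ-least f h = ⋁-least {t = f fzero} {ts = tabulate f} (h fzero ∷ tabulate⁺ {f = f} h)

  ⋀ᶠ-lower : ∀ f i → ev (⋀ᶠ f) ≤ ev (f i)
  ⋀ᶠ-lower f = tabulate⁻ {f = f} (tail (⋀-lower {t = f fzero} {ts = tabulate f}))

  ⋀ᶠ-greatest : ∀ f {u} → (∀ i → u ≤ ev (f i)) → u ≤ ev (⋀ᶠ f)
  ⋀ᶠ-greatest f h = ⋀-greatest {t = f fzero} {ts = tabulate f} (h fzero ∷ tabulate⁺ {f = f} h)

  record Fixes (f : State T → State T) : Set ℓ where
    field fixes : ∀ S → Normal ⟦ S ⟧ˢ → ⟦ f S ⟧ˢ ≋ ⟦ S ⟧ˢ
  open Fixes

  infixr 9 _∘-fixes_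
  _∘-fixes_ : ∀ {f g} → Fixes g → Fixes f → Fixes (g ∘ f)
  (_∘-fixes_ {f} g-fixes f-fixes) .fixes S N =
    ≋-trans (fixes g-fixes (f S) (normal-cong (≋-sym fS≋S) N)) fS≋S
    where fS≋S = fixes f-fixes S N

  ascendChain-o≤y : ∀ k t os ys i →
                    ev (proj₁ (ascendChain k t os ys i)) ≤ ev (proj₂ (ascendChain k t os ys i))
  ascendChain-o≤y k       t os ys fzero    = ≤∨ˡ
  ascendChain-o≤y (suc k) t os ys (fsuc i) = ascendChain-o≤y k _ (os ∘ fsuc) (ys ∘ fsuc) i

  ascendChain-y≤o : ∀ k t os ys (j : Fin k) →
                    ev (proj₂ (ascendChain k t os ys (inject₁ j))) ≤ ev (proj₁ (ascendChain k t os ys (fsuc j)))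
  ascendChain-y≤o (suc k) t os ys fzero    = ≤∨ˡ
  ascendChain-y≤o (suc k) t os ys (fsuc j) = ascendChain-y≤o k _ (os ∘ fsuc) (ys ∘ fsuc) j

  ascendChain-id : ∀ k t os ys → ev t ≤ ev (os fzero) → (∀ i → ev (os i) ≤ ev (ys i)) →
                   (∀ j → ev (ys (inject₁ j)) ≤ ev (os (fsuc j))) →
                   ∀ i → (ev (proj₁ (ascendChain k t os ys i)) ≈ ev (os i)) ×
                         (ev (proj₂ (ascendChain k t os ys i)) ≈ ev (ys i))
  ascendChain-id k t os ys t≤o₀ o≤y y≤o fzero =
    ≤-antisym (∨-least t≤o₀ ≤-refl) ≤∨ʳ , ≤-antisym t∨o₀∨y₀≤y₀ ≤∨ʳ
    where t∨o₀∨y₀≤y₀ = ∨-least (∨-least (t≤o₀ ⨾ o≤y fzero) (o≤y fzero)) ≤-refl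
  ascendChain-id (suc k) t os ys t≤o₀ o≤y y≤o (fsuc i) =
    ascendChain-id k _ (os ∘ fsuc) (ys ∘ fsuc) (t∨o₀∨y₀≤y₀ ⨾ y≤o fzero) (o≤y ∘ fsuc) (y≤o ∘ fsuc) i
    where t∨o₀∨y₀≤y₀ = ∨-least (∨-least (t≤o₀ ⨾ o≤y fzero) (o≤y fzero)) ≤-refl

  ascend-ascending : ∀ S → Ascending ⟦ ascend S ⟧ˢ
  ascend-ascending S = record
    { chain = record
      { b≤o₀ = ≤∨ˡ ; o≤y = ascendChain-o≤y m (b S) (o S) (y S) ; y≤o = ascendChain-y≤o m (b S) (o S) (y S) }
    ; b≤X = ≤∨ʳ ; b≤A = ≤∨ʳ ; b≤C = ≤∨ʳ
    }

  ascend-fixes : Fixes ascend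
  ascend-fixes .fixes S N = record
    { b≈ = refl ; X≈ = y≤x⇒x∨y≈x b≤X ; A≈ = y≤x⇒x∨y≈x b≤A ; C≈ = y≤x⇒x∨y≈x b≤C
    ; o≈ = proj₁ ∘ chain≈ ; y≈ = proj₂ ∘ chain≈ ; z≈ = λ _ → refl
    }
    where
    open Normal N
    chain≈ = ascendChain-id m (b S) (o S) (y S) b≤o₀ o≤y y≤o

  raise-ascending : ∀ s S → Ascending ⟦ S ⟧ˢ → Ascending ⟦ raise s S ⟧ˢ
  raise-ascending s S asc = record
    { chain = record
      { b≤o₀ = ∨-monotonic b≤o₀ ≤-refl
      ; o≤y  = λ i → ∨-monotonic (o≤y i) ≤-refl
      ; y≤o  = λ j → ∨-monotonic (y≤o j) ≤-refl
      }
    ; b≤X = ∨-monotonic b≤X ≤-refl ; b≤A = ∨-monotonic b≤A ≤-refl ; b≤C = ∨-monotonic b≤C ≤-refl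
    }
    where open Ascending asc

  raise-separated : ∀ s S → ev s ≤ span ⟦ S ⟧ˢ → (∀ i → span ⟦ S ⟧ˢ ∧ ev (y S i) ≤ ev (b S) ∨ ev s) →
                    Ascending ⟦ S ⟧ˢ → Separated ⟦ raise s S ⟧ˢ
  raise-separated s S s≤span span∧y≤b∨s asc = record
    { ascending = raise-ascending s S asc
    ; independent = λ i → begin
        span ⟦ raise s S ⟧ˢ ∧ (ev (y S i) ∨ ev s) ≤⟨ ∧-monotonic (span-raise ⟦ S ⟧ˢ s≤span) ∨-comm-≤ ⟩
        span ⟦ S ⟧ˢ ∧ (ev s ∨ ev (y S i))         ≤⟨ ∧-comm-≤ ⨾ modular-≤ s≤span ⟩
        ev s ∨ (ev (y S i) ∧ span ⟦ S ⟧ˢ)         ≤⟨ ∨-least ≤∨ʳ (∧-comm-≤ ⨾ span∧y≤b∨s i) ⟩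
        ev (b S) ∨ ev s                           ∎
    }

  raise-fixes : ∀ s S → Ascending ⟦ S ⟧ˢ → ev s ≤ ev (b S) → ⟦ raise s S ⟧ˢ ≋ ⟦ S ⟧ˢ
  raise-fixes s S asc s≤b = record
    { b≈ = y≤x⇒x∨y≈x s≤b
    ; X≈ = y≤x⇒x∨y≈x (s≤b ⨾ b≤X) ; A≈ = y≤x⇒x∨y≈x (s≤b ⨾ b≤A) ; C≈ = y≤x⇒x∨y≈x (s≤b ⨾ b≤C)
    ; o≈ = λ i → y≤x⇒x∨y≈x (s≤b ⨾ b≤o i)
    ; y≈ = λ i → y≤x⇒x∨y≈x (s≤b ⨾ b≤y i)
    ; z≈ = λ _ → refl
    }
    where open Ascending asc

  separate-separated : ∀ S → Ascending ⟦ S ⟧ˢ → Separated ⟦ separate S ⟧ˢ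
  separate-separated S asc =
    raise-separated (spanᵗ S ⊙ y S (fromℕ m)) S ∧≤ˡ (λ i → ∧-monotonic ≤-refl (y≤top i) ⨾ ≤∨ʳ) asc
    where open Ascending asc

  separate-fixes : Fixes separate
  separate-fixes .fixes S N = raise-fixes (spanᵗ S ⊙ y S (fromℕ m)) S ascending (independent (fromℕ m))
    where open Normal N

  separateXA-separated : ∀ S → Separated ⟦ S ⟧ˢ →
                         let S′ = ⟦ separateXA S ⟧ˢ in Separated S′ × X S′ ∧ A S′ ≤ b S′
  separateXA-separated S sep =
    raise-separated (X S ⊙ A S) S (∧≤ˡ ⨾ ≤∨ˡ ⨾ ≤∨ˡ) (λ i → independent i ⨾ ≤∨ˡ) ascending ,
    (∧-monotonic (∨-least ≤-refl ∧≤ˡ) (∨-least ≤-refl ∧≤ʳ) ⨾ ≤∨ʳ)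
    where open Separated sep

  separateXA-fixes : Fixes separateXA
  separateXA-fixes .fixes S N = raise-fixes (X S ⊙ A S) S ascending (Frame.x∧y≤o baseFrame)
    where open Normal N

  meetBase-meets : ∀ S → (let S₀ = ⟦ S ⟧ˢ in Separated S₀ × X S₀ ∧ A S₀ ≤ b S₀) →
                   Separated ⟦ meetBase S ⟧ˢ × BaseMeets ⟦ meetBase S ⟧ˢ
  meetBase-meets S (sep , X∧A≤b) =
    raise-separated (liftᵗ (C S ⊙ X S) (A S) (C S)) S (∨-least (∧≤ʳ ⨾ ≤∨ˡ ⨾ ≤∨ˡ) (∧≤ʳ ⨾ ≤∨ʳ ⨾ ≤∨ˡ))
      (λ i → independent i ⨾ ≤∨ˡ) ascending ,
    pairwiseMeet-narrow (pairwiseMeet-lift ∧≤ʳ (X∧A≤b ⨾ b≤w) ∧-comm-≤)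
      ≤∨ʳ ≤-refl ≤-refl ≤-refl (∨-monotonic b≤X ≤-refl) (∨-monotonic b≤A ≤-refl) (∨-monotonic b≤C ≤-refl)
    where
    open Separated sep
    b≤w : ev (b S) ≤ ev (C S) ∧ ev (X S)
    b≤w = ∧-greatest b≤C b≤X

  meetBase-fixes : Fixes meetBase
  meetBase-fixes .fixes S N = raise-fixes (liftᵗ (C S ⊙ X S) (A S) (C S)) S ascending
    (∨-least w≤b (∧-monotonic (∨-least (w≤b ⨾ b≤C) ≤-refl) ≤-refl ⨾ ∧-comm-≤ ⨾ y∧z≤o))
    where
    open Normal N
    open Frame baseFrame using (x∧z≤o; y∧z≤o)
    w≤b : ev (C S) ∧ ev (X S) ≤ ev (b S)
    w≤b = ∧-comm-≤ ⨾ x∧z≤o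

  frameBase-framed : ∀ S → Separated ⟦ S ⟧ˢ × BaseMeets ⟦ S ⟧ˢ →
                     Separated ⟦ frameBase S ⟧ˢ × BaseFrame ⟦ frameBase S ⟧ˢ
  frameBase-framed S (sep , M) =
    separated-restrict ⟦ S ⟧ˢ sep (Frame.pairwiseMeet F) ∧≤ˡ ∧≤ʳ ∧≤ʳ o≤y (λ _ → ≤-refl) , F
    where
    open Separated sep
    F = frame-restrict M (∧-greatest b≤X (b≤A ⨾ ≤∨ˡ)) ∧≤ˡ ∧≤ʳ

  frameBase-fixes : Fixes frameBase
  frameBase-fixes .fixes S N = record
    { b≈ = refl ; X≈ = ≤-antisym ∧≤ˡ X≤J ; A≈ = proj₁ restrict≈ ; C≈ = proj₂ restrict≈
    ; o≈ = λ _ → refl ; y≈ = λ _ → refl ; z≈ = λ _ → refl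
    }
    where
    open Normal N
    X≤J = ∧-greatest ≤-refl (Frame.x≤y∨z baseFrame)
    restrict≈ = frame-restrict-id baseFrame X≤J

  boundLevels-bounded : ∀ S → Separated ⟦ S ⟧ˢ × BaseFrame ⟦ S ⟧ˢ →
                        let S′ = ⟦ boundLevels S ⟧ˢ in
                        (Separated S′ × BaseFrame S′) × (∀ i → o S′ i ≤ z S′ i × z S′ i ≤ X S′ ∨ y S′ i)
  boundLevels-bounded S (sep , F) =
    (separated-restrict ⟦ S ⟧ˢ sep (Frame.pairwiseMeet F) ≤-refl ≤-refl ≤-refl o≤y (λ _ → ≤-refl) , F) ,
    λ i → ∧-greatest ≤∨ʳ (o≤y i ⨾ ≤∨ʳ) , ∧≤ʳ
    where open Separated sep

  boundLevels-fixes : Fixes boundLevels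
  boundLevels-fixes .fixes S N = record
    { b≈ = refl ; X≈ = refl ; A≈ = refl ; C≈ = refl ; o≈ = λ _ → refl ; y≈ = λ _ → refl
    ; z≈ = λ i → ≤-antisym (∧≤ˡ ⨾ ∨-least ≤-refl (o≤z i))
                           (∧-greatest ≤∨ˡ (z≤x∨y i ⨾ ∨-least (∨-least ≤∨ˡ (o≤y i ⨾ ≤∨ʳ)) ≤∨ʳ))
    }
    where
    open Normal N
    o≤z = λ i → Frame.o≤z (levelFrame i)
    z≤x∨y = λ i → Frame.z≤x∨y (levelFrame i)

  module MeetLevelsInvariant (S : State T) (sep : Separated ⟦ S ⟧ˢ) (F : BaseFrame ⟦ S ⟧ˢ)
    (bounded : ∀ i → ev (o S i) ≤ ev (z S i) × ev (z S i) ≤ ev (X S) ∨ ev (y S i)) where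

    open LevelLift S
    open Separated sep
    open Frame F using (x∧y≤o; x∧z≤o)
    S′ = ⟦ meetLevels S ⟧ˢ

    w≤X : ev w ≤ ev (X S)
    w≤X = ∨-least b≤X (⋁ᶠ-least (λ i → z S i ⊙ X S) (λ _ → ∧≤ʳ))

    W≤span : ev W ≤ span ⟦ S ⟧ˢ
    W≤span = ∨-least (w≤X ⨾ ≤∨ˡ ⨾ ≤∨ˡ) (∧≤ʳ ⨾ ≤∨ʳ ⨾ ≤∨ˡ)

    σ-least : ∀ i {u} → ev w ≤ u → ev (y S i) ≤ u → ev w₃ ≤ u → ev (σ i) ≤ u
    σ-least i w≤u y≤u w₃≤u = ∨-least (∨-least (∨-least w≤u (o≤y i ⨾ y≤u)) (∧≤ʳ ⨾ y≤u)) w₃≤u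

    separated : Separated S′
    separated = record
      { ascending = record
        { chain = record
          { b≤o₀ = ∨-least (≤∨ˡ ⨾ ≤∨ˡ ⨾ ≤∨ˡ) ≤∨ʳ
          ; o≤y  = λ _ → ≤∨ʳ
          ; y≤o  = λ j → ∨-least (y≤o j ⨾ ≤∨ʳ ⨾ ≤∨ˡ ⨾ ≤∨ˡ)
                                 (σ-least (inject₁ j) (≤∨ˡ ⨾ ≤∨ˡ ⨾ ≤∨ˡ) (y≤o j ⨾ ≤∨ʳ ⨾ ≤∨ˡ ⨾ ≤∨ˡ) ≤∨ʳ)
          }
        ; b≤X = ≤∨ʳ ; b≤A = ≤∨ʳ ; b≤C = ≤∨ʳ
        }
      ; independent = λ i → begin
          span S′ ∧ (ev (y S i) ∨ ev (σ i))  ≤⟨ ∧-monotonic (span-raise ⟦ S ⟧ˢ W≤span) (y∨σ≤W∨y i) ⟩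
          span ⟦ S ⟧ˢ ∧ (ev W ∨ ev (y S i))  ≤⟨ ∧-comm-≤ ⨾ modular-≤ W≤span ⟩
          ev W ∨ (ev (y S i) ∧ span ⟦ S ⟧ˢ)  ≤⟨ ∨-least ≤-refl (∧-comm-≤ ⨾ independent i ⨾ ≤∨ˡ ⨾ ≤∨ˡ) ⟩
          ev W                              ∎
      }
      where
      y∨σ≤W∨y : ∀ i → ev (y S i) ∨ ev (σ i) ≤ ev W ∨ ev (y S i)
      y∨σ≤W∨y i = ∨-least ≤∨ʳ (σ-least i (≤∨ˡ ⨾ ≤∨ˡ) ≤∨ʳ (≤∨ʳ ⨾ ≤∨ˡ))

    baseFrame : BaseFrame S′
    baseFrame = frame-raise F (pairwiseMeet-lift w≤X (x∧y≤o ⨾ ≤∨ˡ) (x∧z≤o ⨾ ≤∨ˡ))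

    -- Lifting by w ∨ oᵢ makes level i meet pairwise in s; w₃ meets X ∨ yᵢ inside s, so joining it
    -- preserves this (pairwiseMeet-∨).
    levelMeets : ∀ i → LevelMeets S′ i
    levelMeets i =
      pairwiseMeet-narrow (pairwiseMeet-∨ lifted x∨s≤X∨y (∨-least ≤∨ʳ s≤X∨y) (∨-least z≤X∨y s≤X∨y) w₃∧X∨y≤s)
        ≤-refl (∨-least (∨-least (≤∨ˡ ⨾ ≤∨ˡ ⨾ ≤∨ˡ) (∨-least (≤∨ˡ ⨾ ≤∨ˡ ⨾ ≤∨ʳ ⨾ ≤∨ˡ) ≤∨ʳ))
                        (∨-monotonic ≤∨ʳ ≤-refl))
        ∨-assoc-≤ ∨-assoc-≤ ≤∨ʳ ≤∨ʳ ≤∨ʳ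
      where
      oᵢ = ev (o S i)
      yᵢ = ev (y S i)
      zᵢ = ev (z S i)
      o≤z = proj₁ (bounded i)
      z≤X∨y = proj₂ (bounded i)
      X∧y≤b : ev (X S) ∧ yᵢ ≤ ev (b S)
      X∧y≤b = ∧-monotonic (≤∨ˡ ⨾ ≤∨ˡ) ≤-refl ⨾ independent i
      z∧X≤w : zᵢ ∧ ev (X S) ≤ ev w
      z∧X≤w = ⋁ᶠ-upper (λ i → z S i ⊙ X S) i ⨾ ≤∨ʳ
      lifted = pairwiseMeet-lift {ev w ∨ oᵢ} {ev (X S) ∨ oᵢ} {yᵢ} {zᵢ} (∨-monotonic w≤X ≤-refl)
        (∧-monotonic ∨-comm-≤ ≤-refl ⨾ modular-≤ (o≤y i) ⨾ ∨-least ≤-refl (X∧y≤b ⨾ b≤o i) ⨾ ≤∨ʳ)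
        (∧-monotonic ∨-comm-≤ ≤-refl ⨾ modular-≤ o≤z ⨾ ∨-least ≤∨ʳ (∧-comm-≤ ⨾ z∧X≤w ⨾ ≤∨ˡ))
      s = lift (ev w ∨ oᵢ) yᵢ zᵢ
      s≤X∨y : s ≤ ev (X S) ∨ yᵢ
      s≤X∨y = ∨-least (∨-least (w≤X ⨾ ≤∨ˡ) (o≤y i ⨾ ≤∨ʳ)) (∧≤ʳ ⨾ ≤∨ʳ)
      x∨s≤X∨y : (ev (X S) ∨ oᵢ) ∨ s ≤ ev (X S) ∨ yᵢ
      x∨s≤X∨y = ∨-least (∨-monotonic ≤-refl (o≤y i)) s≤X∨y
      w₃∧X∨y≤s : ev w₃ ∧ (ev (X S) ∨ yᵢ) ≤ s
      w₃∧X∨y≤s = ∧-monotonic ∧≤ʳ ≤-refl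
               ⨾ independence-exchange b≤X x∧y≤o (∧-monotonic ≤∨ˡ ≤-refl ⨾ independent i)
               ⨾ b≤o i ⨾ ≤∨ʳ ⨾ ≤∨ˡ

  meetLevels-meets : ∀ S → (Separated ⟦ S ⟧ˢ × BaseFrame ⟦ S ⟧ˢ) ×
                           (∀ i → ev (o S i) ≤ ev (z S i) × ev (z S i) ≤ ev (X S) ∨ ev (y S i)) →
                     (Separated ⟦ meetLevels S ⟧ˢ × BaseFrame ⟦ meetLevels S ⟧ˢ) ×
                     (∀ i → LevelMeets ⟦ meetLevels S ⟧ˢ i)
  meetLevels-meets S ((sep , F) , bounded) = (separated , baseFrame) , levelMeets
    where open MeetLevelsInvariant S sep F bounded

  meetLevels-fixes : Fixes meetLevels
  meetLevels-fixes .fixes S N = record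
    { b≈ = ≤-antisym W≤b (≤∨ˡ ⨾ ≤∨ˡ)
    ; X≈ = y≤x⇒x∨y≈x (W≤b ⨾ b≤X) ; A≈ = y≤x⇒x∨y≈x (W≤b ⨾ b≤A) ; C≈ = y≤x⇒x∨y≈x (W≤b ⨾ b≤C)
    ; o≈ = λ i → ≤-antisym (σ≤o i) (≤∨ʳ ⨾ ≤∨ˡ ⨾ ≤∨ˡ)
    ; y≈ = λ i → y≤x⇒x∨y≈x (σ≤o i ⨾ o≤y i)
    ; z≈ = λ i → y≤x⇒x∨y≈x (σ≤o i ⨾ Frame.o≤z (levelFrame i))
    }
    where
    open LevelLift S
    open Normal N
    z∧X≤b : ∀ i → ev (z S i) ∧ ev (X S) ≤ ev (b S)
    z∧X≤b i = ∧-greatest ∧≤ʳ (∧-greatest (∧≤ʳ ⨾ ≤∨ˡ) ∧≤ˡ) ⨾ ∧-monotonic ≤-refl (Frame.x∧z≤o (levelFrame i))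
            ⨾ ∧-monotonic (≤∨ˡ ⨾ ≤∨ˡ) (o≤y i) ⨾ independent i
    w≤b : ev w ≤ ev (b S)
    w≤b = ∨-least ≤-refl (⋁ᶠ-least (λ i → z S i ⊙ X S) z∧X≤b)
    w₃≤b : ev w₃ ≤ ev (b S)
    w₃≤b = ∧-monotonic (∨-least (w≤b ⨾ b≤C) ≤-refl) ≤-refl ⨾ ∧-comm-≤ ⨾ Frame.y∧z≤o baseFrame
    W≤b : ev W ≤ ev (b S)
    W≤b = ∨-least w≤b w₃≤b
    σ≤o : ∀ i → ev (σ i) ≤ ev (o S i)
    σ≤o i = ∨-least (∨-least (∨-least (w≤b ⨾ b≤o i) ≤-refl) φ≤o) (w₃≤b ⨾ b≤o i)
      where
      open Frame (levelFrame i) using (o≤z; y∧z≤o)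
      φ≤o = ∧-monotonic (∨-least (∨-least (w≤b ⨾ b≤o i ⨾ o≤z) o≤z) ≤-refl) ≤-refl ⨾ ∧-comm-≤ ⨾ y∧z≤o

  frameLevels-normal : ∀ S → (Separated ⟦ S ⟧ˢ × BaseFrame ⟦ S ⟧ˢ) × (∀ i → LevelMeets ⟦ S ⟧ˢ i) →
                       Normal ⟦ frameLevels S ⟧ˢ
  frameLevels-normal S ((sep , F) , M) = record
    { separated  = separated-restrict ⟦ S ⟧ˢ sep (Frame.pairwiseMeet baseFrame′) ∧≤ˡ ∧≤ʳ ∧≤ʳ
                     (Frame.o≤y ∘ levelFrame′) (λ _ → ∧≤ʳ)
    ; baseFrame  = baseFrame′
    ; levelFrame = levelFrame′
    }
    where
    open Separated sep
    J = ev (coreX S)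
    b≤J : ev (b S) ≤ J
    b≤J = ∧-greatest b≤X (⋀ᶠ-greatest (λ i → y S i ⊕ z S i) (λ i → b≤y i ⨾ ≤∨ˡ))
    baseFrame′ = frame-restrict (Frame.pairwiseMeet F) b≤J ∧≤ˡ (∧≤ˡ ⨾ Frame.x≤y∨z F)
    levelFrame′ : ∀ i → LevelFrame ⟦ frameLevels S ⟧ˢ i
    levelFrame′ i = frame-restrict (M i) ≤∨ʳ (∨-monotonic ∧≤ˡ ≤-refl)
                      (∨-least (∧≤ʳ ⨾ ⋀ᶠ-lower (λ i → y S i ⊕ z S i) i) (o≤y i ⨾ ≤∨ˡ))

  frameLevels-fixes : Fixes frameLevels
  frameLevels-fixes .fixes S N = record
    { b≈ = refl ; X≈ = ≤-antisym ∧≤ˡ X≤J ; A≈ = proj₁ base≈ ; C≈ = proj₂ base≈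
    ; o≈ = λ _ → refl ; y≈ = proj₁ ∘ level≈ ; z≈ = proj₂ ∘ level≈
    }
    where
    open Normal N
    X≤J : ev (X S) ≤ ev (coreX S)
    X≤J = ∧-greatest ≤-refl (⋀ᶠ-greatest (λ i → y S i ⊕ z S i) (λ i → ≤∨ˡ ⨾ Frame.x≤y∨z (levelFrame i)))
    base≈ = frame-restrict-id baseFrame X≤J
    level≈ = λ i → frame-restrict-id (levelFrame i) (∨-monotonic X≤J ≤-refl)

  normalize-normal : ∀ S → Normal ⟦ normalize S ⟧ˢ
  normalize-normal S =
    let S₁ = ascend S ; S₂ = separate S₁ ; S₃ = separateXA S₂ ; S₄ = meetBase S₃
        S₅ = frameBase S₄ ; S₆ = boundLevels S₅ ; S₇ = meetLevels S₆ in
    frameLevels-normal S₇ (meetLevels-meets S₆ (boundLevels-bounded S₅ (frameBase-framed S₄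
      (meetBase-meets S₃ (separateXA-separated S₂ (separate-separated S₁ (ascend-ascending S)))))))

  normalize-fixes : Fixes normalize
  normalize-fixes =
    frameLevels-fixes ∘-fixes meetLevels-fixes ∘-fixes boundLevels-fixes ∘-fixes frameBase-fixes ∘-fixes
    meetBase-fixes ∘-fixes separateXA-fixes ∘-fixes separate-fixes ∘-fixes ascend-fixes

  module NormalOutput (S : State T) (N : Normal ⟦ S ⟧ˢ) where

    open Normal N
    private module Out = Evaluation L (λ g → ev (output S g))

    X∨top : Carrier
    X∨top = ev (X S) ∨ ev (y S (fromℕ m))

    sumΔ≤X∨top : Out.ev (sumΔ m) ≤ X∨top
    sumΔ≤X∨top = Out.⋁-least {t = var (a⊥ fzero)} {ts = concatMap generators (allFin (suc m))}
      (o≤X∨top fzero ∷ All-concatMap⁺ {f = generators} λ k →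
      o≤X∨top k ∷ ∨-least ≤∨ˡ (o≤X∨top k) ∷ y≤X∨top k ∷
      (Frame.z≤x∨y (levelFrame k) ⨾ ∨-least (∨-least ≤∨ˡ (o≤X∨top k)) (y≤X∨top k)) ∷ [])
      where
      y≤X∨top = λ k → y≤top k ⨾ ≤∨ʳ
      o≤X∨top = λ k → o≤y k ⨾ y≤X∨top k

    sumΔ∧A∨o₀≈o₀ : Out.ev (sumΔ m) ∧ (ev (A S) ∨ ev (o S fzero)) ≈ ev (o S fzero)
    sumΔ∧A∨o₀≈o₀ = ≤-antisym (begin
      Out.ev (sumΔ m) ∧ (ev (A S) ∨ o₀)  ≤⟨ ∧-comm-≤ ⨾ ∧-monotonic ∨-comm-≤ sumΔ≤X∨top ⟩
      (o₀ ∨ ev (A S)) ∧ X∨top            ≤⟨ modular-≤ (o≤y fzero ⨾ y≤top fzero ⨾ ≤∨ʳ) ⟩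
      o₀ ∨ (ev (A S) ∧ X∨top)            ≤⟨ ∨-least ≤-refl (A∧X∨top≤b ⨾ b≤o₀) ⟩
      o₀                                 ∎)
      (∧-greatest (head (Out.⋁-upper {t = var (a⊥ fzero)} {ts = concatMap generators (allFin (suc m))})) ≤∨ʳ)
      where
      o₀ = ev (o S fzero)
      A∧X∨top≤b = independence-exchange b≤X (Frame.x∧y≤o baseFrame)
                    (∧-monotonic ≤∨ˡ ≤-refl ⨾ independent (fromℕ m))

    ↗-levels : ∀ k → IsModel (towerStep k) L (λ g → ev (output S g))
    ↗-levels k = Out.↗-pair⁺ ≤∨ʳ (∨-least (∨-monotonic ≤-refl (o≤y k′ ⨾ y≤o k)) (y≤o k ⨾ ≤∨ʳ)) (y≤o k) ≤∨ʳ
                             (∨-monotonic (≤∨ˡ ⨾ ≤∨ˡ) ≤-refl) o′∧x≤y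
      where
      k′ = inject₁ k
      o′∧x≤y : ev (o S (fsuc k)) ∧ ((ev (X S) ∨ ev (o S k′)) ∨ ev (y S k′)) ≤ ev (y S k′)
      o′∧x≤y = begin
        ev (o S (fsuc k)) ∧ ((ev (X S) ∨ ev (o S k′)) ∨ ev (y S k′))
          ≤⟨ ∧-comm-≤ ⨾ ∧-monotonic (∨-least (∨-least ≤∨ʳ (o≤y k′ ⨾ ≤∨ˡ)) ≤∨ˡ) ≤-refl ⟩
        (ev (y S k′) ∨ ev (X S)) ∧ ev (o S (fsuc k))  ≤⟨ modular-≤ (y≤o k) ⟩
        ev (y S k′) ∨ (ev (X S) ∧ ev (o S (fsuc k)))
          ≤⟨ ∨-least ≤-refl (∧-monotonic (≤∨ˡ ⨾ ≤∨ˡ) (o≤y (fsuc k)) ⨾ independent (fsuc k) ⨾ b≤y k′) ⟩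
        ev (y S k′) ∎

    isModel : ∀ {h} → IsModel (Δ3 (suc m) h) L (λ g → ev (output S g))
    isModel = ++⁺ (++⁺ (All-concatMap⁺ (Out.frame2⁺ ∘ levelFrame)) (All-concatMap⁺ ↗-levels))
                  (≤-antisym (∧-greatest ≤-refl ≤∨ʳ) ∧≤ˡ ∷ sumΔ∧A∨o₀≈o₀ ∷
                   Out.frame2⁺ (frame-∨ baseFrame (≤∨ˡ ⨾ ≤∨ˡ) (≤∨ʳ ⨾ ≤∨ˡ) ≤∨ʳ o₀∧span≤b b≤o₀))
      where
      o₀∧span≤b = ∧-comm-≤ ⨾ ∧-monotonic ≤-refl (o≤y fzero) ⨾ independent fzero

  output-cong : ∀ {S S′} → ⟦ S ⟧ˢ ≋ ⟦ S′ ⟧ˢ → ∀ g → ev (output S g) ≈ ev (output S′ g)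
  output-cong E (a⊥ k)  = _≋_.o≈ E k
  output-cong E (a₁ k)  = ∨-cong (_≋_.X≈ E) (_≋_.o≈ E k)
  output-cong E (a₂ k)  = _≋_.y≈ E k
  output-cong E (c₁₂ k) = _≋_.z≈ E k
  output-cong E a₃      = ∨-cong (_≋_.A≈ E) (_≋_.o≈ E fzero)
  output-cong E c₁₃     = ∨-cong (_≋_.C≈ E) (_≋_.o≈ E fzero)

  module ModelInput {h} (M : IsModel (Δ3 (suc m) h) L a) where

    towerHolds  = ++⁻ˡ (towerRels m) M
    frame3Holds = ++⁻ʳ (towerRels m) M
    framesHold  = ++⁻ˡ (concatMap towerFrame (allFin (suc m))) towerHolds
    stepsHold   = ++⁻ʳ (concatMap towerFrame (allFin (suc m))) towerHolds

    levelFrame : ∀ k → Frame (a (a⊥ k)) (a (a₁ k)) (a (a₂ k)) (a (c₁₂ k))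
    levelFrame = frame2⁻ ∘ All-concatMap⁻ {f = towerFrame} framesHold

    ↗-level = ↗-pair⁻ ∘ All-concatMap⁻ {f = towerStep} stepsHold

    baseFrame : Frame (a (a⊥ fzero)) (a (a₁ fzero)) (a a₃) (a c₁₃)
    baseFrame = frame2⁻ (tail (tail frame3Holds))

    X₀ = a (a₁ fzero)
    b₀ = a (a⊥ fzero)

    generator≤sumΔ : ∀ k → All (λ t → ev t ≤ ev (sumΔ m)) (generators k)
    generator≤sumΔ = All-concatMap⁻ {f = generators}
                       (tail (⋁-upper {t = var (a⊥ fzero)} {ts = concatMap generators (allFin (suc m))}))

    a₁-decomposes : ∀ i → (a (a₁ i) ≈ X₀ ∨ a (a⊥ i)) × (X₀ ∧ a (a₂ i) ≤ b₀)
    a₁-decomposes = <-weakInduction _ (≤-antisym ≤∨ˡ (∨-least ≤-refl (Frame.o≤x (levelFrame fzero))) ,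
                                       Frame.x∧y≤o (levelFrame fzero)) step
      where
      step : ∀ k → (a (a₁ (inject₁ k)) ≈ X₀ ∨ a (a⊥ (inject₁ k))) × (X₀ ∧ a (a₂ (inject₁ k)) ≤ b₀) →
                   (a (a₁ (fsuc k)) ≈ X₀ ∨ a (a⊥ (fsuc k))) × (X₀ ∧ a (a₂ (fsuc k)) ≤ b₀)
      step k (a₁≈ , X∧a₂≤b) = a₁′≈ , X∧a₂′≤b
        where
        open Frame (levelFrame (fsuc k)) using (o≤x; x∧y≤o)
        a₁′-↗   = proj₁ (↗-level k)
        a₂≤a⊥′  = proj₁ (proj₂ (↗-level k))
        a⊥′∧≤a₂ = proj₂ (proj₂ (↗-level k))
        a⊥≤a₂ = Frame.o≤y (levelFrame (inject₁ k))
        X≤a₁ : X₀ ≤ a (a₁ (inject₁ k))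
        X≤a₁ = ≤∨ˡ ⨾ ≤-reflexive (sym a₁≈)
        a₁′≈ : a (a₁ (fsuc k)) ≈ X₀ ∨ a (a⊥ (fsuc k))
        a₁′≈ = trans a₁′-↗ (≤-antisym
          (∨-least (∨-least (≤-reflexive a₁≈ ⨾ ∨-monotonic ≤-refl (a⊥≤a₂ ⨾ a₂≤a⊥′))
                            (a₂≤a⊥′ ⨾ ≤∨ʳ))
                   (∧≤ʳ ⨾ ≤∨ʳ))
          (∨-least (X≤a₁ ⨾ ≤∨ˡ ⨾ ≤∨ˡ) (∧-greatest o≤x ≤-refl ⨾ ≤∨ʳ)))
        X∧a₂′≤b : X₀ ∧ a (a₂ (fsuc k)) ≤ b₀
        X∧a₂′≤b = ∧-greatest ∧≤ˡ (∧-monotonic (≤∨ˡ ⨾ ≤-reflexive (sym a₁′≈)) ≤-refl ⨾ x∧y≤o)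
                ⨾ ∧-greatest ∧≤ˡ (∧-greatest ∧≤ʳ (∧≤ˡ ⨾ X≤a₁ ⨾ ≤∨ˡ ⨾ ≤∨ˡ) ⨾ a⊥′∧≤a₂)
                ⨾ X∧a₂≤b

    input-normal : Normal ⟦ input ⟧ˢ
    input-normal = record
      { separated = record
        { ascending = record
          { chain = record
            { b≤o₀ = ≤-refl
            ; o≤y  = Frame.o≤y ∘ levelFrame
            ; y≤o  = proj₁ ∘ proj₂ ∘ ↗-level
            }
          ; b≤X = o≤x ; b≤A = o≤y ; b≤C = o≤z
          }
        ; independent = independent
        }
      ; baseFrame  = baseFrame
      ; levelFrame = λ i → frame-cong refl (proj₁ (a₁-decomposes i)) refl refl (levelFrame i)
      }
      where
      open Frame baseFrame
      independent : ∀ i → ((X₀ ∨ a a₃) ∨ a c₁₃) ∧ a (a₂ i) ≤ b₀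
      independent i = begin
        ((X₀ ∨ a a₃) ∨ a c₁₃) ∧ a (a₂ i)  ≤⟨ ∧-greatest (∧-monotonic (∨-least ≤-refl z≤x∨y) ≤∨ʳ) ∧≤ʳ ⟩
        ((X₀ ∨ a a₃) ∧ (X₀ ∨ a (a₂ i))) ∧ a (a₂ i) ≤⟨ ∧-monotonic (modular-≤ ≤∨ˡ) ≤-refl ⟩
        (X₀ ∨ (a a₃ ∧ (X₀ ∨ a (a₂ i)))) ∧ a (a₂ i) ≤⟨ ∧-monotonic (∨-least ≤-refl a₃∧≤b) ≤-refl ⟩
        X₀ ∧ a (a₂ i)                             ≤⟨ proj₂ (a₁-decomposes i) ⟩
        b₀                                        ∎
        where
        a₃∧≤b : a a₃ ∧ (X₀ ∨ a (a₂ i)) ≤ X₀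
        a₃∧≤b = ∧-monotonic ≤-refl (∨-least (head (tail (generator≤sumΔ fzero)))
                                            (head (tail (tail (generator≤sumΔ i)))))
              ⨾ ∧-comm-≤ ⨾ ≤-reflexive (head (tail frame3Holds)) ⨾ o≤x

    output-input : ∀ g → ev (output input g) ≈ a g
    output-input (a⊥ k)  = refl
    output-input (a₁ k)  = sym (proj₁ (a₁-decomposes k))
    output-input (a₂ k)  = refl
    output-input (c₁₂ k) = refl
    output-input a₃      = y≤x⇒x∨y≈x (Frame.o≤y baseFrame)
    output-input c₁₃     = y≤x⇒x∨y≈x (Frame.o≤z baseFrame)

  normalize-model : ∀ {h} S → IsModel (Δ3 (suc m) h) L (λ g → ev (output (normalize S) g))
  normalize-model {h} S = NormalOutput.isModel (normalize S) (normalize-normal S) {h}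

  -- Stated for an arbitrary S: instantiated with input inside this module, the conversion checker
  -- would unfold the (exponentially large) normalized terms.
  normalize-retract : ∀ S → Normal ⟦ S ⟧ˢ → (∀ g → ev (output S g) ≈ a g) →
                      ∀ g → ev (output (normalize S) g) ≈ a g
  normalize-retract S N output≈ g = trans (output-cong (fixes normalize-fixes S N) g) (output≈ g)

-- Imported only here, so that _≤_ means the lattice order in the modules above.
open import Data.Nat using (_≤_)

lemma3p7 : (n : ℕ) → (h : 1 ≤ n) → Projective (Δ3 n h)
lemma3p7 zero ()
lemma3p7 (suc m) h = record
  { terms   = output (normalize input)
  ; model   = λ L a → Steps.normalize-model L m a {h} input
  ; retract = λ L a M → let open Steps.ModelInput L m a {h} M in
                        Steps.normalize-retract L m a input input-normal output-input
  }
  where open Construction m using (output; normalize; input)
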